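{- Let $a\ge2$ be an even integer. The subtraction set of the subtraction game $\mathcal{S}(1,a,a+1)$ has expansion $\big(\{1,3,\ldots,a-1\}\cup\{a\}\cup\{a+1,a+3,\ldots,2a-1\}\big)^{*(2a)}$.
   Context: For a finite set $S$ of positive integers, the subtraction game $\mathcal{S}(S)$ is played on a single pile: two players alternately remove $s\in S$ coins (at most the pile size); the last mover wins. The nim-value is $\mathcal{G}(n)=\operatorname{mex}\{\mathcal{G}(n-s): s\in S, s\le n\}$. The expansion of $S$ is $S^{ex}=\{s\ge1:\mathcal{G}(n+s)\ne\mathcal{G}(n)\ \forall n\ge0\}$; "has expansion $T$" means $S^{ex}=T$. For a set $X$ and $p\ge1$, $X^{*p}=\{x+mp:x\in X,m\ge0\}$. -}

module Defs where

open import Data.Nat using (ℕ; zero; suc; _+_; _*_; _∸_; _≤_; _<_; _≡ᵇ_)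
open import Data.Nat.Properties using (_≤?_)
open import Data.Bool using (Bool; true; false; if_then_else_)
open import Data.List using (List; []; _∷_)
open import Data.Bool.ListAction using (any)
open import Data.List.Membership.Propositional using (_∈_)
open import Data.Product using (_×_; ∃-syntax)
open import Relation.Binary.PropositionalEquality using (_≡_; _≢_)
open import Relation.Nullary.Decidable using (⌊_⌋)

-- mex of a list of naturals: least natural not in the list.
-- mexFrom k fuel xs: least m ≥ k not in xs, searching with fuel (length xs + 1 suffices).
elemᵇ : ℕ → List ℕ → Bool
elemᵇ m xs = any (λ x → x ≡ᵇ m) xs

mexFrom : ℕ → ℕ → List ℕ → ℕ
mexFrom k zero xs = k
mexFrom k (suc fuel) xs = if elemᵇ k xs then mexFrom (suc k) fuel xs else k

len : List ℕ → ℕ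
len [] = 0
len (_ ∷ xs) = suc (len xs)

mex : List ℕ → ℕ
mex xs = mexFrom 0 (suc (len xs)) xs

-- lookup in a list (default 0 out of range)
at : List ℕ → ℕ → ℕ
at [] _ = 0
at (x ∷ xs) zero = x
at (x ∷ xs) (suc i) = at xs i

-- options: nim-values G(n - s) for s ∈ S with 1 ≤ s ≤ n,
-- given prev = [G(n-1), G(n-2), ..., G(0)] (so G(n-s) = at prev (s-1)).
options : List ℕ → ℕ → List ℕ → List ℕ
options [] n prev = []
options (s ∷ S) n prev with ⌊ 1 ≤? s ⌋ | ⌊ s ≤? n ⌋
... | true | true = at prev (s ∸ 1) ∷ options S n prev
... | _    | _    = options S n prev

table : List ℕ → ℕ → List ℕ
table S zero = []
table S (suc n) = mex (options S n (table S n)) ∷ table S n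

grundy : List ℕ → ℕ → ℕ
grundy S n = mex (options S n (table S n))

InExpansion : List ℕ → ℕ → Set
InExpansion S s = (1 ≤ s) × (∀ n → grundy S (n + s) ≢ grundy S n)

Star : (ℕ → Set) → ℕ → ℕ → Set
Star X p y = ∃[ x ] ∃[ m ] (X x × y ≡ x + m * p)

Odd : ℕ → Set
Odd x = ∃[ k ] x ≡ suc (2 * k)

-- Split the positions into blocks of length a, writing n = q·a + r with r < a.  The
-- nim-values are determined by two parities:
--     G(q·a + r) = code (parity q) (parity r),   code p r ∈ {0, 1, 2, 3},
-- proved by induction on (q, r) after computing, from the definition of the table, which
-- options each position has (inside a block the three options carry three of the four
-- codes; at a block start likewise, the preceding offset a − 1 being odd).
-- Since a is even, this closed form yields three facts: G(n) ≡ n (mod 2); G has period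
-- 2a; and G(n + a) ≠ G(n).  Hence every odd move and every move a + 2am lies in the
-- expansion.  Conversely, for a move s ≡ x (mod 2a) with x even and x ≠ a, the
-- positions 0 (if x < a) or 2a − x (if x > a) of the first block have the same
-- nim-value as their image under s.
module Submission where

open import Defs
open import Data.Nat using (ℕ; zero; suc; _+_; _*_; _∸_; _≤_)
open import Data.Nat.Divisibility using (_∣_)
open import Data.List using (List; []; _∷_)
open import Data.Sum using (_⊎_)
open import Data.Product using (_×_)
open import Relation.Binary.PropositionalEquality using (_≡_)
open import Function.Bundles using (_⇔_)

open import Data.Nat using (_<_; z≤n; s≤s; parity)
open import Data.Nat.Properties
  using (_≤?_; <-cmp; ≤-pred; ≤-trans; n<1+n; <-trans; m≤m+n; <⇒≱; +-suc; +-assoc; +-comm;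
         +-identityʳ; *-comm; *-identityˡ; +-monoʳ-<; +-cancelʳ-<; m∸n+n≡m; <⇒≤)
open import Data.Nat.DivMod using (_%_; _/_; m≡m%n+[m/n]*n; m%n<n)
open import Data.Nat.Divisibility using (divides)
open import Data.Nat.Tactic.RingSolver using (solve-∀)
open import Data.Parity.Base as ℙ using (Parity; 0ℙ; 1ℙ; _⁻¹)
import Data.Parity.Properties as Parityₚ
open import Data.Sum using (inj₁; inj₂)
open import Data.Product using (_,_; ∃-syntax)
open import Data.Empty using (⊥-elim)
open import Relation.Nullary using (yes; no; contradiction)
open import Relation.Binary using (tri<; tri≈; tri>)
open import Relation.Binary.PropositionalEquality
  using (_≢_; refl; sym; trans; cong; subst; module ≡-Reasoning)
open import Function.Bundles using (mk⇔)

parity-suc : ∀ n → parity (suc n) ≡ parity n ⁻¹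
parity-suc n = Parityₚ.+-homo-+ 1 n

parity-*-even : ∀ m n → parity n ≡ 0ℙ → parity (m * n) ≡ 0ℙ
parity-*-even m n n-even = begin
  parity (m * n)           ≡⟨ Parityₚ.*-homo-* m n ⟩
  parity m ℙ.* parity n    ≡⟨ cong (parity m ℙ.*_) n-even ⟩
  parity m ℙ.* 0ℙ          ≡⟨ Parityₚ.*-zeroʳ (parity m) ⟩
  0ℙ                       ∎
  where open ≡-Reasoning

parity-even-+ : ∀ y x → parity y ≡ 0ℙ → parity (y + x) ≡ parity x
parity-even-+ y x y-even = trans (Parityₚ.+-homo-+ y x) (cong (ℙ._+ parity x) y-even)

parity-+-even : ∀ x y → parity y ≡ 0ℙ → parity (x + y) ≡ parity x
parity-+-even x y y-even = trans (cong parity (+-comm x y)) (parity-even-+ y x y-even)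

Odd⇒parity : ∀ {x} → Odd x → parity x ≡ 1ℙ
Odd⇒parity (k , refl) =
  trans (parity-suc (2 * k)) (cong _⁻¹ (trans (cong parity (*-comm 2 k)) (parity-*-even k 2 refl)))

Odd⇒positive : ∀ {x} → Odd x → 1 ≤ x
Odd⇒positive (_ , refl) = s≤s z≤n

parity⇒Odd : ∀ x → parity x ≡ 1ℙ → Odd x
parity⇒Odd (suc zero) _ = 0 , refl
parity⇒Odd (suc (suc x)) x-odd with parity⇒Odd x x-odd
... | k , refl = suc k , cong (λ y → suc (suc y)) (sym (+-suc k (k + 0)))

table-lookup : ∀ T k m → at (table T (suc (k + m))) k ≡ grundy T m
table-lookup T zero    m = refl
table-lookup T (suc k) m = table-lookup T k m

options-take : ∀ T S k {n} m → n ≡ suc k + m →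
  options (suc k ∷ S) n (table T n) ≡ grundy T m ∷ options S n (table T n)
options-take T S k m refl with 1 ≤? suc k | suc k ≤? suc k + m
... | yes _ | yes _  = cong (_∷ options S (suc k + m) (table T (suc k + m))) (table-lookup T k m)
... | no ¬p | _      = ⊥-elim (¬p (s≤s z≤n))
... | yes _ | no ¬q  = ⊥-elim (¬q (m≤m+n (suc k) m))

options-skip : ∀ {s S n prev} → n < s → options (s ∷ S) n prev ≡ options S n prev
options-skip {s} {S} {n} n<s with 1 ≤? s | s ≤? n
... | yes _ | yes s≤n = ⊥-elim (<⇒≱ n<s s≤n)
... | yes _ | no _    = refl
... | no _  | _       = refl

-- The four nim-values of S(1, a, a+1): `code p r` is the value at an index lying in a
-- block (of length a) of parity p, at an offset of parity r.
code : Parity → Parity → ℕ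
code 0ℙ 0ℙ = 0
code 0ℙ 1ℙ = 1
code 1ℙ 0ℙ = 2
code 1ℙ 1ℙ = 3

parity-code : ∀ p r → parity (code p r) ≡ r
parity-code 0ℙ 0ℙ = refl
parity-code 0ℙ 1ℙ = refl
parity-code 1ℙ 0ℙ = refl
parity-code 1ℙ 1ℙ = refl

code-flip : ∀ p r → code (p ⁻¹) r ≢ code p r
code-flip 0ℙ 0ℙ ()
code-flip 0ℙ 1ℙ ()
code-flip 1ℙ 0ℙ ()
code-flip 1ℙ 1ℙ ()

-- The mex computations of the recursion; in the two three-option cases the options are
-- three of the four codes and the mex is the missing fourth one.
-- A position of the first block has the single option n − 1.
mex-single : ∀ {c c′} → c′ ≡ c ⁻¹ → mex (code 0ℙ c ∷ []) ≡ code 0ℙ c′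
mex-single {0ℙ} refl = refl
mex-single {1ℙ} refl = refl

mex-interior : ∀ {p p′ c c′} → p′ ≡ p ⁻¹ → c′ ≡ c ⁻¹ →
  mex (code p′ c ∷ code p c′ ∷ code p c ∷ []) ≡ code p′ c′
mex-interior {0ℙ} {c = 0ℙ} refl refl = refl
mex-interior {0ℙ} {c = 1ℙ} refl refl = refl
mex-interior {1ℙ} {c = 0ℙ} refl refl = refl
mex-interior {1ℙ} {c = 1ℙ} refl refl = refl

mex-block-start : ∀ {p p′} → p ≡ p′ ⁻¹ →
  mex (code p 1ℙ ∷ code p 0ℙ ∷ code p′ 1ℙ ∷ []) ≡ code p′ 0ℙ
mex-block-start {p′ = 0ℙ} refl = refl
mex-block-start {p′ = 1ℙ} refl = refl

mex-cong₃ : ∀ {x x′ y y′ z z′} → x ≡ x′ → y ≡ y′ → z ≡ z′ →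
  mex (x ∷ y ∷ z ∷ []) ≡ mex (x′ ∷ y′ ∷ z′ ∷ [])
mex-cong₃ refl refl refl = refl

-- Index arithmetic for the first position of block q + 2 (with a = suc a₁): it is
-- 1, a and a + 1 past the last position of block q + 1, the first position of
-- block q + 1 and the last position of block q.
block-start-minus-1 : ∀ a₁ q → suc (suc q) * suc a₁ + 0 ≡ suc (suc q * suc a₁ + a₁)
block-start-minus-1 = solve-∀

block-start-minus-a : ∀ a₁ q → suc (suc q) * suc a₁ + 0 ≡ suc a₁ + (suc q * suc a₁ + 0)
block-start-minus-a = solve-∀

block-start-minus-a+1 : ∀ a₁ q → suc (suc q) * suc a₁ + 0 ≡ suc (suc a₁) + (q * suc a₁ + a₁)
block-start-minus-a+1 = solve-∀

module SubtractionGame (a₁ : ℕ) (a-even : parity (suc a₁) ≡ 0ℙ) where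

  a : ℕ
  a = suc a₁

  S : List ℕ
  S = 1 ∷ a ∷ suc a ∷ []

  G : ℕ → ℕ
  G = grundy S

  a₁-odd : parity a₁ ≡ 1ℙ
  a₁-odd = sym (Parityₚ.⁻¹-selfInverse (trans (sym (parity-suc a₁)) a-even))

  period-even : parity (2 * a) ≡ 0ℙ
  period-even = parity-*-even 2 a a-even

  options-below : ∀ {n} m → n ≡ suc m → n < a → options S n (table S n) ≡ G m ∷ []
  options-below {n} m n≡1+m n<a = begin
    options S n (table S n)                             ≡⟨ options-take S _ 0 m n≡1+m ⟩
    G m ∷ options (a ∷ suc a ∷ []) n (table S n)        ≡⟨ cong (G m ∷_) (options-skip n<a) ⟩
    G m ∷ options (suc a ∷ []) n (table S n)            ≡⟨ cong (G m ∷_) (options-skip (<-trans n<a (n<1+n a))) ⟩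
    G m ∷ []                                            ∎
    where open ≡-Reasoning

  options-at : ∀ {n} → n ≡ a → options S n (table S n) ≡ G a₁ ∷ G 0 ∷ []
  options-at {n} n≡a = begin
    options S n (table S n)                             ≡⟨ options-take S _ 0 a₁ n≡a ⟩
    G a₁ ∷ options (a ∷ suc a ∷ []) n (table S n)       ≡⟨ cong (G a₁ ∷_) (options-take S _ a₁ 0 n≡a+0) ⟩
    G a₁ ∷ G 0 ∷ options (suc a ∷ []) n (table S n)     ≡⟨ cong (λ os → G a₁ ∷ G 0 ∷ os) (options-skip n<1+a) ⟩
    G a₁ ∷ G 0 ∷ []                                     ∎
    where
    open ≡-Reasoning
    n≡a+0 : n ≡ a + 0
    n≡a+0 = trans n≡a (sym (+-identityʳ a))
    n<1+a : n < suc a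
    n<1+a = subst (_< suc a) (sym n≡a) (n<1+n a)

  options-above : ∀ {n} m₁ m₂ m₃ → n ≡ suc m₁ → n ≡ a + m₂ → n ≡ suc a + m₃ →
    options S n (table S n) ≡ G m₁ ∷ G m₂ ∷ G m₃ ∷ []
  options-above {n} m₁ m₂ m₃ e₁ e₂ e₃ = begin
    options S n (table S n)                             ≡⟨ options-take S _ 0 m₁ e₁ ⟩
    G m₁ ∷ options (a ∷ suc a ∷ []) n (table S n)       ≡⟨ cong (G m₁ ∷_) (options-take S _ a₁ m₂ e₂) ⟩
    G m₁ ∷ G m₂ ∷ options (suc a ∷ []) n (table S n)    ≡⟨ cong (λ os → G m₁ ∷ G m₂ ∷ os) (options-take S _ a m₃ e₃) ⟩
    G m₁ ∷ G m₂ ∷ G m₃ ∷ []                             ∎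
    where open ≡-Reasoning

  -- It is proved together with its instance at the (odd) last offset a₁ of a block; the
  -- cases are: start of the game, first block, position a, later block starts, and
  -- interior positions of later blocks.
  grundy-closed : ∀ q r → r < a → G (q * a + r) ≡ code (parity q) (parity r)
  grundy-last-offset : ∀ q → G (q * a + a₁) ≡ code (parity q) 1ℙ

  grundy-closed zero zero _ = refl
  grundy-closed zero (suc r) 1+r<a = begin
    G (suc r)                        ≡⟨ cong mex (options-below r refl 1+r<a) ⟩
    mex (G r ∷ [])                   ≡⟨ cong (λ v → mex (v ∷ [])) (grundy-closed zero r r<a) ⟩
    mex (code 0ℙ (parity r) ∷ [])    ≡⟨ mex-single (parity-suc r) ⟩
    code 0ℙ (parity (suc r))         ∎
    where
    open ≡-Reasoning
    r<a : r < a
    r<a = <-trans (n<1+n r) 1+r<a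
  grundy-closed (suc zero) zero _ = begin
    G (1 * a + 0)                    ≡⟨ cong mex (options-at (trans (+-identityʳ (1 * a)) (*-identityˡ a))) ⟩
    mex (G a₁ ∷ G 0 ∷ [])            ≡⟨ cong (λ v → mex (v ∷ G 0 ∷ [])) (grundy-last-offset zero) ⟩
    code 1ℙ 0ℙ                       ∎
    where open ≡-Reasoning
  grundy-closed (suc (suc q)) zero _ = begin
    G (suc (suc q) * a + 0)
      ≡⟨ cong mex (options-above (suc q * a + a₁) (suc q * a + 0) (q * a + a₁)
                    (block-start-minus-1 a₁ q) (block-start-minus-a a₁ q) (block-start-minus-a+1 a₁ q)) ⟩
    mex (G (suc q * a + a₁) ∷ G (suc q * a + 0) ∷ G (q * a + a₁) ∷ [])
      ≡⟨ mex-cong₃ (grundy-last-offset (suc q)) (grundy-closed (suc q) zero (s≤s z≤n)) (grundy-last-offset q) ⟩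
    mex (code (parity (suc q)) 1ℙ ∷ code (parity (suc q)) 0ℙ ∷ code (parity q) 1ℙ ∷ [])
      ≡⟨ mex-block-start (parity-suc q) ⟩
    code (parity q) 0ℙ
      ∎
    where open ≡-Reasoning
  grundy-closed (suc q) (suc r) 1+r<a = begin
    G (suc q * a + suc r)
      ≡⟨ cong mex (options-above (suc q * a + r) (q * a + suc r) (q * a + r) e₁ e₂ e₃) ⟩
    mex (G (suc q * a + r) ∷ G (q * a + suc r) ∷ G (q * a + r) ∷ [])
      ≡⟨ mex-cong₃ (grundy-closed (suc q) r r<a) (grundy-closed q (suc r) 1+r<a) (grundy-closed q r r<a) ⟩
    mex (code (parity (suc q)) (parity r) ∷ code (parity q) (parity (suc r)) ∷ code (parity q) (parity r) ∷ [])
      ≡⟨ mex-interior (parity-suc q) (parity-suc r) ⟩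
    code (parity (suc q)) (parity (suc r))
      ∎
    where
    open ≡-Reasoning
    r<a : r < a
    r<a = <-trans (n<1+n r) 1+r<a
    e₁ : suc q * a + suc r ≡ suc (suc q * a + r)
    e₁ = +-suc (suc q * a) r
    e₂ : suc q * a + suc r ≡ a + (q * a + suc r)
    e₂ = +-assoc a (q * a) (suc r)
    e₃ : suc q * a + suc r ≡ suc a + (q * a + r)
    e₃ = trans e₁ (cong suc (+-assoc a (q * a) r))

  grundy-last-offset q = trans (grundy-closed q a₁ (n<1+n a₁)) (cong (code (parity q)) a₁-odd)

  block-decomposition : ∀ n → ∃[ q ] ∃[ r ] (r < a × n ≡ q * a + r)
  block-decomposition n =
    n / a , n % a , m%n<n n a , trans (m≡m%n+[m/n]*n n a) (+-comm (n % a) _)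

  -- G(n) ≡ n (mod 2), because the block length a is even.
  parity-grundy : ∀ n → parity (G n) ≡ parity n
  parity-grundy n with block-decomposition n
  ... | q , r , r<a , refl = begin
    parity (G (q * a + r))                    ≡⟨ cong parity (grundy-closed q r r<a) ⟩
    parity (code (parity q) (parity r))       ≡⟨ parity-code (parity q) (parity r) ⟩
    parity r                                  ≡⟨ sym (parity-even-+ (q * a) r (parity-*-even q a a-even)) ⟩
    parity (q * a + r)                        ∎
    where open ≡-Reasoning

  -- G is periodic with period 2a: shifting by 2a moves two blocks.
  grundy-periodic : ∀ m n → G (n + m * (2 * a)) ≡ G n
  grundy-periodic m n with block-decomposition n
  ... | q , r , r<a , refl = begin
    G (q * a + r + m * (2 * a))               ≡⟨ cong G (shift q r m a) ⟩
    G ((q + m * 2) * a + r)                   ≡⟨ grundy-closed (q + m * 2) r r<a ⟩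
    code (parity (q + m * 2)) (parity r)      ≡⟨ cong (λ p → code p (parity r)) (parity-+-even q (m * 2) (parity-*-even m 2 refl)) ⟩
    code (parity q) (parity r)                ≡⟨ sym (grundy-closed q r r<a) ⟩
    G (q * a + r)                             ∎
    where
    open ≡-Reasoning
    shift : ∀ q r m a → q * a + r + m * (2 * a) ≡ (q + m * 2) * a + r
    shift = solve-∀

  -- Shifting by a moves one block and thus always changes the nim-value.
  grundy-shift-a : ∀ n → G (n + a) ≢ G n
  grundy-shift-a n with block-decomposition n
  ... | q , r , r<a , refl = λ same → code-flip (parity q) (parity r) (begin
    code (parity q ⁻¹) (parity r)             ≡⟨ cong (λ p → code p (parity r)) (sym (parity-suc q)) ⟩
    code (parity (suc q)) (parity r)          ≡⟨ sym (grundy-closed (suc q) r r<a) ⟩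
    G (suc q * a + r)                         ≡⟨ cong G (shift q r a) ⟩
    G (q * a + r + a)                         ≡⟨ same ⟩
    G (q * a + r)                             ≡⟨ grundy-closed q r r<a ⟩
    code (parity q) (parity r)                ∎)
    where
    open ≡-Reasoning
    shift : ∀ q r a → suc q * a + r ≡ q * a + r + a
    shift = solve-∀

  grundy-first-block-even : ∀ y → y < a → parity y ≡ 0ℙ → G y ≡ G 0
  grundy-first-block-even y y<a y-even = trans (grundy-closed zero y y<a) (cong (code 0ℙ) y-even)

  Base : ℕ → Set
  Base x = (Odd x × 1 ≤ x × x ≤ a ∸ 1) ⊎ (x ≡ a) ⊎ (Odd x × suc a ≤ x × x ≤ 2 * a ∸ 1)

  -- An odd move changes the parity of the position, hence of its nim-value.
  odd-changes : ∀ s → parity s ≡ 1ℙ → ∀ n → G (n + s) ≢ G n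
  odd-changes s s-odd n same = Parityₚ.p≢p⁻¹ (parity n) (begin
    parity n                  ≡⟨ sym (parity-grundy n) ⟩
    parity (G n)              ≡⟨ cong parity (sym same) ⟩
    parity (G (n + s))        ≡⟨ parity-grundy (n + s) ⟩
    parity (n + s)            ≡⟨ Parityₚ.+-homo-+ n s ⟩
    parity n ℙ.+ parity s     ≡⟨ cong (parity n ℙ.+_) s-odd ⟩
    parity n ℙ.+ 1ℙ           ≡⟨ Parityₚ.+-comm (parity n) 1ℙ ⟩
    parity n ⁻¹               ∎)
    where open ≡-Reasoning

  -- A move a + 2am acts like a shift by a.
  a-changes : ∀ m n → G (n + (a + m * (2 * a))) ≢ G n
  a-changes m n same = grundy-shift-a n (begin
    G (n + a)                       ≡⟨ sym (grundy-periodic m (n + a)) ⟩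
    G (n + a + m * (2 * a))         ≡⟨ cong G (+-assoc n a (m * (2 * a))) ⟩
    G (n + (a + m * (2 * a)))       ≡⟨ same ⟩
    G n                             ∎)
    where open ≡-Reasoning

  odd-shift-in-expansion : ∀ x m → Odd x → InExpansion S (x + m * (2 * a))
  odd-shift-in-expansion x m x-odd =
    ≤-trans (Odd⇒positive x-odd) (m≤m+n x _) ,
    odd-changes _ (trans (parity-+-even x _ (parity-*-even m (2 * a) period-even)) (Odd⇒parity x-odd))

  star-in-expansion : ∀ s → Star Base (2 * a) s → InExpansion S s
  star-in-expansion _ (x , m , inj₁ (x-odd , _) , refl) = odd-shift-in-expansion x m x-odd
  star-in-expansion _ (x , m , inj₂ (inj₂ (x-odd , _)) , refl) = odd-shift-in-expansion x m x-odd
  star-in-expansion _ (x , m , inj₂ (inj₁ refl) , refl) = s≤s z≤n , a-changes m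

  -- An even x < a is not in the expansion mod 2a: the move x + 2am from 0 reaches an
  -- even position of the first block.
  small-even-collision : ∀ x m → x < a → parity x ≡ 0ℙ → G (0 + (x + m * (2 * a))) ≡ G 0
  small-even-collision x m x<a x-even =
    trans (grundy-periodic m x) (grundy-first-block-even x x<a x-even)

  -- An even x with a < x < 2a is not in the expansion mod 2a: the move x + 2am from the
  -- even position n = 2a − x < a of the first block reaches 2a ≡ 0 (mod 2a).
  large-even-collision : ∀ x m → a < x → x < 2 * a → parity x ≡ 0ℙ →
    G ((2 * a ∸ x) + (x + m * (2 * a))) ≡ G (2 * a ∸ x)
  large-even-collision x m a<x x<2a x-even = begin
    G (n + (x + m * (2 * a)))       ≡⟨ cong G (sym (+-assoc n x _)) ⟩
    G (n + x + m * (2 * a))         ≡⟨ grundy-periodic m (n + x) ⟩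
    G (n + x)                       ≡⟨ cong G n+x≡2a ⟩
    G (2 * a)                       ≡⟨ cong G (sym (*-identityˡ (2 * a))) ⟩
    G (0 + 1 * (2 * a))             ≡⟨ grundy-periodic 1 0 ⟩
    G 0                             ≡⟨ sym (grundy-first-block-even n n<a n-even) ⟩
    G n                             ∎
    where
    open ≡-Reasoning
    n : ℕ
    n = 2 * a ∸ x
    n+x≡2a : n + x ≡ 2 * a
    n+x≡2a = m∸n+n≡m (<⇒≤ x<2a)
    n<a : n < a
    n<a = +-cancelʳ-< a n a (subst (n + a <_) (trans n+x≡2a (cong (a +_) (+-identityʳ a))) (+-monoʳ-< n a<x))
    n-even : parity n ≡ 0ℙ
    n-even = trans (sym (parity-+-even n x x-even)) (trans (cong parity n+x≡2a) period-even)

  residue-in-base : ∀ x m → x < 2 * a → (∀ n → G (n + (x + m * (2 * a))) ≢ G n) → Base x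
  residue-in-base x m x<2a changes with parity x in x-parity | <-cmp x a
  ... | 1ℙ | tri< x<a _ _  = inj₁ (parity⇒Odd x x-parity , Odd⇒positive (parity⇒Odd x x-parity) , ≤-pred x<a)
  ... | 1ℙ | tri≈ _ refl _ = contradiction (trans (sym x-parity) a-even) λ ()
  ... | 1ℙ | tri> _ _ a<x  = inj₂ (inj₂ (parity⇒Odd x x-parity , a<x , ≤-pred x<2a))
  ... | 0ℙ | tri≈ _ x≡a _  = inj₂ (inj₁ x≡a)
  ... | 0ℙ | tri< x<a _ _  = ⊥-elim (changes 0 (small-even-collision x m x<a x-parity))
  ... | 0ℙ | tri> _ _ a<x  = ⊥-elim (changes (2 * a ∸ x) (large-even-collision x m a<x x<2a x-parity))

  expansion-in-star : ∀ s → InExpansion S s → Star Base (2 * a) s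
  expansion-in-star s (_ , changes) =
    s % (2 * a) , s / (2 * a) ,
    residue-in-base (s % (2 * a)) (s / (2 * a)) (m%n<n s (2 * a)) (λ n → subst (λ t → G (n + t) ≢ G n) s≡x+m2a (changes n)) ,
    s≡x+m2a
    where
    s≡x+m2a : s ≡ s % (2 * a) + s / (2 * a) * (2 * a)
    s≡x+m2a = m≡m%n+[m/n]*n s (2 * a)

  expansion : ∀ s → InExpansion S s ⇔ Star Base (2 * a) s
  expansion s = mk⇔ (expansion-in-star s) (star-in-expansion s)

theorem3p4 : (a : ℕ) → 2 ≤ a → 2 ∣ a →
    (s : ℕ) → InExpansion (1 ∷ a ∷ suc a ∷ []) s ⇔
      Star (λ x → (Odd x × 1 ≤ x × x ≤ a ∸ 1) ⊎ (x ≡ a) ⊎ (Odd x × suc a ≤ x × x ≤ 2 * a ∸ 1)) (2 * a) s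
theorem3p4 (suc a₁) (s≤s _) (divides k a≡k*2) = SubtractionGame.expansion a₁ a-even
  where
  a-even : parity (suc a₁) ≡ 0ℙ
  a-even = trans (cong parity a≡k*2) (parity-*-even k 2 refl)
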